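{- Let $\Sigma$ be a set, $F$ a set of functions $f:\wp(\Sigma)^{n_f}\to\wp(\Sigma)$, and $(\mathcal{A},\le)$ a complete lattice together with maps $\alpha:\mathrm{Abs}(\wp(\Sigma))\to\mathcal{A}$, $\gamma:\mathcal{A}\to\mathrm{Abs}(\wp(\Sigma))$ forming a Galois insertion of $\mathcal{A}_{\ge}$ into $\mathrm{Abs}(\wp(\Sigma))_{\sqsupseteq}$, i.e. $\alpha,\gamma$ are monotone, $\alpha(X)\ge a \iff X\sqsupseteq\gamma(a)$ for all $X\in\mathrm{Abs}(\wp(\Sigma))$, $a\in\mathcal{A}$, and $\alpha(\gamma(a))=a$ for all $a$. Assume $(\mathcal{A},\le)$ satisfies the descending chain condition and that one of the following holds: (i) $\mathcal{A}$ is backward complete for $F^{\mathcal{M}}$, i.e. $\alpha\circ F^{\mathcal{M}}=\alpha\circ F^{\mathcal{M}}\circ\gamma\circ\alpha$; (ii) $\mathcal{A}$ is forward complete for $\mathscr{S}_F$, i.e. $\mathscr{S}_F\circ\gamma\circ\alpha=\gamma\circ\alpha\circ\mathscr{S}_F\circ\gamma\circ\alpha$. Then for every $a\in\mathcal{A}$, every run of the algorithm $\mathrm{GPT}^{\mathcal{A}}_F$ on input $a$ terminates and its output equals $\alpha(\mathscr{S}_F(\gamma(a)))$.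
   Context: An abstract domain of $\wp(\Sigma)$ is identified with a Moore family, i.e. a set $A\subseteq\wp(\Sigma)$ closed under arbitrary intersections (so $\Sigma\in A$); $\mathrm{Abs}(\wp(\Sigma))$ is the set of these. For $X\subseteq\wp(\Sigma)$, $\mathcal{M}(X)=\{\bigcap Y\mid Y\subseteq X\}$ (with $\bigcap\varnothing=\Sigma$). Order: $A_1\sqsubseteq A_2$ iff $A_2\subseteq A_1$; this is a complete lattice with meet $A_1\sqcap A_2=\mathcal{M}(A_1\cup A_2)$ and join given by intersection. For $X\subseteq\wp(\Sigma)$, $F(X)=\{f(\vec s)\mid f\in F,\ \vec s\in X^{n_f}\}$ and $F^{\mathcal{M}}(X)=\mathcal{M}(F(X))$. $A$ is forward $F$-complete if $F(A)\subseteq A$; $\mathscr{S}_F(A)=\bigsqcup\{X\mid X\sqsubseteq A,\ X\text{ forward }F\text{ -complete}\}$ (the forward $F$-complete shell). For $f\in F$, $\vec S\in\wp(\Sigma)^{n_f}$ and abstract domain $A$: $\mathrm{refine}_f(\vec S,A)=\mathcal{M}(A\cup\{f(\vec S)\})$. For $a\in\mathcal{A}$: $\mathrm{refine}^{\mathcal{A}}_f(\vec S,a)=\alpha(\mathrm{refine}_f(\vec S,\gamma(a)))$; $\mathrm{refiners}^{\mathcal{A}}_f(a)=\{\vec S\in\gamma(a)^{n_f}\mid \mathrm{refine}^{\mathcal{A}}_f(\vec S,a)<a\}$; $\mathrm{refiners}^{\mathcal{A}}_F(a)=\bigcup_{f\in F}\mathrm{refiners}^{\mathcal{A}}_f(a)$.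 The nondeterministic algorithm $\mathrm{GPT}^{\mathcal{A}}_F$ on input $a$: while $\mathrm{refiners}^{\mathcal{A}}_F(a)\neq\varnothing$, choose some $f\in F$ and $\vec S\in\mathrm{refiners}^{\mathcal{A}}_f(a)$ and set $a:=\mathrm{refine}^{\mathcal{A}}_f(\vec S,a)$; output $a$. -}

module Defs where

open import Level using (Level; _⊔_; suc; Lift; lift; lower)
open import Data.Nat using (ℕ)
open import Data.Fin using (Fin)
open import Data.Product using (Σ; _×_; _,_; proj₁; proj₂)
open import Data.Sum using (_⊎_; inj₁; inj₂)
open import Relation.Nullary using (¬_)
open import Relation.Unary using (Pred)
open import Relation.Binary.Bundles using (Poset)
open import Relation.Binary.PropositionalEquality using (_≡_)
open import Relation.Binary.Construct.Closure.ReflexiveTransitive using (Star)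
open import Induction.WellFounded using (WellFounded; Acc)

record CompleteLattice (c ℓ₁ ℓ₂ : Level) : Set (suc (c ⊔ ℓ₁ ⊔ ℓ₂)) where
  field
    poset : Poset c ℓ₁ ℓ₂
  open Poset poset public
  IsLub : Pred Carrier c → Carrier → Set (c ⊔ ℓ₂)
  IsLub P x = (∀ y → P y → y ≤ x) × (∀ z → (∀ y → P y → y ≤ z) → x ≤ z)
  field
    ⨆     : Pred Carrier c → Carrier
    ⨆-lub : ∀ P → IsLub P (⨆ P)

  _<_ : Carrier → Carrier → Set (ℓ₁ ⊔ ℓ₂)
  x < y = x ≤ y × ¬ (x ≈ y)

  -- descending chain condition: no infinite strictly descending chain,
  -- rendered as well-foundedness of _<_
  DCC : Set (c ⊔ ℓ₁ ⊔ ℓ₂)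
  DCC = WellFounded _<_

module _ {ℓ : Level} (St : Set ℓ) where

  ℘ : Set (suc ℓ)
  ℘ = St → Set ℓ

module _ {ℓ : Level} {St : Set ℓ} where

  _⊆ₛ_ : ℘ St → ℘ St → Set ℓ
  S ⊆ₛ T = ∀ x → S x → T x

  _≐_ : ℘ St → ℘ St → Set ℓ
  S ≐ T = (S ⊆ₛ T) × (T ⊆ₛ S)

  -- intersection of an (ℓ-small indexed) family of subsets;
  -- the empty family gives the whole of St
  ⋂ : {I : Set ℓ} → (I → ℘ St) → ℘ St
  ⋂ g x = ∀ i → g i x

  Family : Set (suc (suc ℓ))
  Family = ℘ St → Set (suc ℓ)

  record IsMoore (A : Family) : Set (suc ℓ) where
    field
      -- A is a set of subsets: membership respects equality of subsets
      resp : ∀ {S T} → S ≐ T → A S → A T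
      meet : ∀ {I : Set ℓ} (g : I → ℘ St) → (∀ i → A (g i)) → A (⋂ g)

module _ {ℓ : Level} (St : Set ℓ) where

  record Abs : Set (suc (suc ℓ)) where
    constructor mkAbs
    field
      dom   : Family {St = St}
      moore : IsMoore dom

open Abs public

module _ {ℓ : Level} {St : Set ℓ} where

  _⊑_ : Abs St → Abs St → Set (suc ℓ)
  A₁ ⊑ A₂ = ∀ S → dom A₂ S → dom A₁ S

  _≅_ : Abs St → Abs St → Set (suc ℓ)
  A₁ ≅ A₂ = (A₁ ⊑ A₂) × (A₂ ⊑ A₁)

  -- Moore closure  M(X) = { ⋂ Y | Y ⊆ X }
  ℳ-dom : Family {St = St} → Family {St = St}
  ℳ-dom X S = Σ (Set ℓ) λ I → Σ (I → ℘ St) λ g → (∀ i → X (g i)) × (S ≐ ⋂ g)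

  ℳ-moore : (X : Family {St = St}) → IsMoore (ℳ-dom X)
  ℳ-moore X = record { resp = rsp ; meet = mt }
    where
    rsp : ∀ {S T} → S ≐ T → ℳ-dom X S → ℳ-dom X T
    rsp (st , ts) (I , g , gX , (s⊆ , ⊆s)) =
      I , g , gX , ((λ x Tx → s⊆ x (ts x Tx)) , (λ x gx → st x (⊆s x gx)))
    mt : ∀ {J : Set ℓ} (h : J → ℘ St) → (∀ j → ℳ-dom X (h j)) → ℳ-dom X (⋂ h)
    mt {J} h p =
      Σ J (λ j → proj₁ (p j)) ,
      (λ { (j , i) → proj₁ (proj₂ (p j)) i }) ,
      (λ { (j , i) → proj₁ (proj₂ (proj₂ (p j))) i }) ,
      ( (λ x hx → λ { (j , i) → proj₁ (proj₂ (proj₂ (proj₂ (p j)))) x (hx j) i })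
      , (λ x Gx j → proj₂ (proj₂ (proj₂ (proj₂ (p j)))) x (λ i → Gx (j , i))) )

  ℳ : Family {St = St} → Abs St
  ℳ X = mkAbs (ℳ-dom X) (ℳ-moore X)

record FunSet {ℓ : Level} (St : Set ℓ) : Set (suc (suc ℓ)) where
  field
    Fn  : Set (suc ℓ)
    ar  : Fn → ℕ
    app : (f : Fn) → (Fin (ar f) → ℘ St) → ℘ St
    app-resp : ∀ f {s t : Fin (ar f) → ℘ St} → (∀ i → s i ≐ t i) → app f s ≐ app f t

open FunSet public

module _ {ℓ : Level} {St : Set ℓ} (F : FunSet St) where

  Fimg : Family {St = St} → Family {St = St}
  Fimg X S = Σ (Fn F) λ f → Σ (Fin (ar F f) → ℘ St) λ s → (∀ i → X (s i)) × (S ≐ app F f s)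

  F^ℳ : Abs St → Abs St
  F^ℳ X = ℳ (Fimg (dom X))

  FwdComplete : Abs St → Set (suc ℓ)
  FwdComplete A = ∀ S → Fimg (dom A) S → dom A S

  IsFwdShell : Abs St → Abs St → Set (suc (suc ℓ))
  IsFwdShell A B =
      (∀ X → X ⊑ A → FwdComplete X → X ⊑ B)
    × (∀ U → (∀ X → X ⊑ A → FwdComplete X → X ⊑ U) → B ⊑ U)

  refine : (f : Fn F) → (Fin (ar F f) → ℘ St) → Abs St → Abs St
  refine f s A = ℳ (λ T → dom A T ⊎ Lift (suc ℓ) (T ≐ app F f s))

module _ {ℓ c ℓ₁ ℓ₂ : Level} {St : Set ℓ} (L : CompleteLattice c ℓ₁ ℓ₂) where
  open CompleteLattice L

  record GaloisInsertion (α : Abs St → Carrier) (γ : Carrier → Abs St)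
         : Set (suc (suc ℓ) ⊔ c ⊔ ℓ₁ ⊔ ℓ₂) where
    field
      α-mono : ∀ {X Y} → X ⊑ Y → α X ≤ α Y
      γ-mono : ∀ {a b} → a ≤ b → γ a ⊑ γ b
      gc     : ∀ X a → (a ≤ α X → γ a ⊑ X) × (γ a ⊑ X → a ≤ α X)
      αγ     : ∀ a → α (γ a) ≈ a

module GPT {ℓ c ℓ₁ ℓ₂ : Level} {St : Set ℓ} (F : FunSet St)
           (L : CompleteLattice c ℓ₁ ℓ₂)
           (α : Abs St → CompleteLattice.Carrier L)
           (γ : CompleteLattice.Carrier L → Abs St) where
  open CompleteLattice L

  refineᴬ : (f : Fn F) → (Fin (ar F f) → ℘ St) → Carrier → Carrier
  refineᴬ f s a = α (refine F f s (γ a))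

  Refiner : (f : Fn F) → Carrier → (Fin (ar F f) → ℘ St) → Set (suc ℓ ⊔ ℓ₁ ⊔ ℓ₂)
  Refiner f a s = (∀ i → dom (γ a) (s i)) × (refineᴬ f s a < a)

  NoRefiners : Carrier → Set (suc ℓ ⊔ ℓ₁ ⊔ ℓ₂)
  NoRefiners a = ∀ f s → ¬ Refiner f a s

  Step : Carrier → Carrier → Set (suc ℓ ⊔ c ⊔ ℓ₁ ⊔ ℓ₂)
  Step a b = Σ (Fn F) λ f → Σ (Fin (ar F f) → ℘ St) λ s → Refiner f a s × (b ≡ refineᴬ f s a)

  -- b is reached from a by a step (reverse orientation, for Acc)
  _◁_ : Carrier → Carrier → Set (suc ℓ ⊔ c ⊔ ℓ₁ ⊔ ℓ₂)
  b ◁ a = Step a b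

  -- every run from a terminates: there is no infinite sequence of steps from a
  AllRunsTerminate : Carrier → Set (suc ℓ ⊔ c ⊔ ℓ₁ ⊔ ℓ₂)
  AllRunsTerminate a = Acc _◁_ a

  Output : Carrier → Carrier → Set (suc ℓ ⊔ c ⊔ ℓ₁ ⊔ ℓ₂)
  Output a b = Star Step a b × NoRefiners b

{-# OPTIONS --safe #-}
-- Every step of GPT strictly descends in 𝒜, so the descending chain condition
-- makes all runs finite. A final value b has no refiners, which (classically)
-- means that γ b is forward F-complete; as b ≤ a, the shell property gives
-- b ≤ α (𝒮 (γ a)). Conversely d = α (𝒮 (γ a)) is a lower bound of every value
-- of a run: a refinement step only adds f(s) for s ∈ γ(current) ⊆ γ d, which
-- stays in γ d as soon as γ d is forward F-complete. Either completeness
-- hypothesis provides exactly this forward completeness of γ (α (𝒮 (γ a))).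
module Submission where

open import Defs
open import Level using (Level; _⊔_; Lift; lift) renaming (suc to lsuc)
open import Data.Product using (_×_; _,_; proj₁; proj₂; swap)
open import Data.Sum using (_⊎_; inj₁; inj₂)
open import Data.Unit.Polymorphic using (⊤; tt)
open import Data.Fin using (Fin)
open import Data.Empty using (⊥-elim)
open import Axiom.ExcludedMiddle using (ExcludedMiddle)
open import Relation.Nullary using (yes; no)
open import Relation.Binary.Bundles using (Setoid)
open import Relation.Binary.PropositionalEquality using (refl)
open import Relation.Binary.Construct.Closure.ReflexiveTransitive using (Star; fold)
open import Induction.WellFounded using (module Subrelation)

Star-preserves : ∀ {a r p} {A : Set a} {R : A → A → Set r} (P : A → Set p)
               → (∀ {x y} → R x y → P x → P y) → ∀ {x y} → Star R x y → P x → P y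
Star-preserves P step = fold (λ x y → P x → P y) (λ r k Px → k (step r Px)) (λ Px → Px)

module _ {ℓ : Level} {St : Set ℓ} where

  ≐-refl : {S : ℘ St} → S ≐ S
  ≐-refl = (λ _ x → x) , (λ _ x → x)

  ≐-sym : {S T : ℘ St} → S ≐ T → T ≐ S
  ≐-sym (S⊆T , T⊆S) = T⊆S , S⊆T

  ≐-trans : {S T U : ℘ St} → S ≐ T → T ≐ U → S ≐ U
  ≐-trans (S⊆T , T⊆S) (T⊆U , U⊆T) = (λ x Sx → T⊆U x (S⊆T x Sx)) , (λ x Ux → T⊆S x (U⊆T x Ux))

  ⋂-singleton : {S : ℘ St} → S ≐ ⋂ {I = ⊤} (λ _ → S)
  ⋂-singleton = (λ _ Sx _ → Sx) , (λ _ Sx → Sx tt)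

  ≅-setoid : Setoid (lsuc (lsuc ℓ)) (lsuc ℓ)
  ≅-setoid = record
    { Carrier       = Abs St
    ; _≈_           = _≅_
    ; isEquivalence = record
      { refl  = (λ _ As → As) , (λ _ As → As)
      ; sym   = λ (A⊑B , B⊑A) → B⊑A , A⊑B
      ; trans = λ (A⊑B , B⊑A) (B⊑C , C⊑B) →
                  (λ S Cs → A⊑B S (B⊑C S Cs)) , (λ S As → C⊑B S (B⊑A S As))
      }
    }

  ℳ-extensive : (X : Family {St = St}) {T : ℘ St} → X T → dom (ℳ X) T
  ℳ-extensive X {T} XT = ⊤ , (λ _ → T) , (λ _ → XT) , ⋂-singleton

  ℳ-least : (A : Abs St) (X : Family {St = St}) → (∀ T → X T → dom A T) → A ⊑ ℳ X
  ℳ-least A X X⊆A T (I , g , gX , T≐⋂g) =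
    IsMoore.resp (moore A) (≐-sym T≐⋂g) (IsMoore.meet (moore A) g (λ i → X⊆A (g i) (gX i)))

module ForwardCompleteness {ℓ : Level} {St : Set ℓ} (F : FunSet St) where

  FwdComplete-resp-≅ : (A B : Abs St) → A ≅ B → FwdComplete F A → FwdComplete F B
  FwdComplete-resp-≅ A B (A⊑B , B⊑A) A-complete S (f , s , Bs , S≐fs) =
    B⊑A S (A-complete S (f , s , (λ i → A⊑B (s i) (Bs i)) , S≐fs))

  FwdComplete⇒⊑F^ℳ : (A : Abs St) → FwdComplete F A → A ⊑ F^ℳ F A
  FwdComplete⇒⊑F^ℳ A = ℳ-least A (Fimg F (dom A))

  ⊑F^ℳ⇒FwdComplete : (A : Abs St) → A ⊑ F^ℳ F A → FwdComplete F A
  ⊑F^ℳ⇒FwdComplete A A⊑F^ℳA S FAS = A⊑F^ℳA S (ℳ-extensive (Fimg F (dom A)) FAS)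

  adjoin : (f : Fn F) → (Fin (ar F f) → ℘ St) → Abs St → Family {St = St}
  adjoin f s A T = dom A T ⊎ Lift (lsuc ℓ) (T ≐ app F f s)

  refine-⊑ : ∀ f s (A : Abs St) → refine F f s A ⊑ A
  refine-⊑ f s A T AT = ℳ-extensive (adjoin f s A) (inj₁ AT)

  refine-∋ : ∀ f s (A : Abs St) → dom (refine F f s A) (app F f s)
  refine-∋ f s A = ℳ-extensive (adjoin f s A) (inj₂ (lift ≐-refl))

  refine-greatest : ∀ f s (A X : Abs St) → X ⊑ A → dom X (app F f s) → X ⊑ refine F f s A
  refine-greatest f s A X X⊑A X∋fs = ℳ-least X (adjoin f s A) λ
    { T (inj₁ AT)         → X⊑A T AT
    ; T (inj₂ (lift T≐fs)) → IsMoore.resp (moore X) (≐-sym T≐fs) X∋fs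
    }

  -- Built inductively: intersecting all forward-complete X ⊑ A would quantify
  -- over Abs St, which lives one universe above the families.
  data InShell (A : Abs St) : ℘ St → Set (lsuc ℓ) where
    base  : ∀ {S} → dom A S → InShell A S
    apply : ∀ {S} f (s : Fin (ar F f) → ℘ St)
          → (∀ i → InShell A (s i)) → S ≐ app F f s → InShell A S
    meet  : ∀ {S} {I : Set ℓ} (g : I → ℘ St)
          → (∀ i → InShell A (g i)) → S ≐ ⋂ g → InShell A S

  shell : Abs St → Abs St
  shell A = mkAbs (InShell A) record
    { resp = λ {S} S≐T SA → meet (λ _ → S) (λ _ → SA) (≐-trans (≐-sym S≐T) ⋂-singleton)
    ; meet = λ g gA → meet g gA ≐-refl
    }

  shell-fwdComplete : (A : Abs St) → FwdComplete F (shell A)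
  shell-fwdComplete A S (f , s , sA , S≐fs) = apply f s sA S≐fs

  shell-greatest : ∀ {A} (X : Abs St) → X ⊑ A → FwdComplete F X → X ⊑ shell A
  shell-greatest X X⊑A X-complete S (base AS) = X⊑A S AS
  shell-greatest X X⊑A X-complete S (apply f s sA S≐fs) =
    X-complete S (f , s , (λ i → shell-greatest X X⊑A X-complete (s i) (sA i)) , S≐fs)
  shell-greatest X X⊑A X-complete S (meet g gA S≐⋂g) =
    IsMoore.resp (moore X) (≐-sym S≐⋂g)
      (IsMoore.meet (moore X) g (λ i → shell-greatest X X⊑A X-complete (g i) (gA i)))

  IsFwdShell-⊑ : (A B : Abs St) → IsFwdShell F A B → B ⊑ A
  IsFwdShell-⊑ A B (_ , least) = least A (λ X X⊑A _ → X⊑A)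

  IsFwdShell-≅-shell : (A B : Abs St) → IsFwdShell F A B → B ≅ shell A
  IsFwdShell-≅-shell A B (upper , least) =
    least (shell A) shell-greatest , upper (shell A) (λ S → base) (shell-fwdComplete A)

  IsFwdShell-fwdComplete : (A B : Abs St) → IsFwdShell F A B → FwdComplete F B
  IsFwdShell-fwdComplete A B isShell =
    FwdComplete-resp-≅ (shell A) B (swap (IsFwdShell-≅-shell A B isShell)) (shell-fwdComplete A)

  IsFwdShell-mono : (A A′ B B′ : Abs St)
                  → IsFwdShell F A B → IsFwdShell F A′ B′ → A ⊑ A′ → B ⊑ B′
  IsFwdShell-mono A A′ B B′ (_ , least) (upper′ , _) A⊑A′ =
    least B′ (λ X X⊑A X-complete → upper′ X (λ S A′S → X⊑A S (A⊑A′ S A′S)) X-complete)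

  IsFwdShell-resp-≅ : (A A′ B B′ : Abs St)
                    → IsFwdShell F A B → IsFwdShell F A′ B′ → A ≅ A′ → B ≅ B′
  IsFwdShell-resp-≅ A A′ B B′ isShell isShell′ (A⊑A′ , A′⊑A) =
      IsFwdShell-mono A A′ B B′ isShell isShell′ A⊑A′
    , IsFwdShell-mono A′ A B′ B isShell′ isShell A′⊑A

module GaloisInsertionProperties
    {ℓ c ℓ₁ ℓ₂ : Level} {St : Set ℓ} {L : CompleteLattice c ℓ₁ ℓ₂}
    {α : Abs St → CompleteLattice.Carrier L} {γ : CompleteLattice.Carrier L → Abs St}
    (GI : GaloisInsertion L α γ) where
  open CompleteLattice L
  open GaloisInsertion GI

  ≤α⇒γ⊑ : ∀ {a X} → a ≤ α X → γ a ⊑ X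
  ≤α⇒γ⊑ = proj₁ (gc _ _)

  γ⊑⇒≤α : ∀ {a X} → γ a ⊑ X → a ≤ α X
  γ⊑⇒≤α = proj₂ (gc _ _)

  ⊑γ⇒α≤ : ∀ {X a} → X ⊑ γ a → α X ≤ a
  ⊑γ⇒α≤ X⊑γa = trans (α-mono X⊑γa) (reflexive (αγ _))

  γ-resp-≈ : ∀ {a b} → a ≈ b → γ a ≅ γ b
  γ-resp-≈ a≈b = γ-mono (reflexive a≈b) , γ-mono (reflexive (Eq.sym a≈b))

  α-resp-≅ : ∀ {A B} → A ≅ B → α A ≈ α B
  α-resp-≅ (A⊑B , B⊑A) = antisym (α-mono A⊑B) (α-mono B⊑A)

module Completeness
    {ℓ c ℓ₁ ℓ₂ : Level} {St : Set ℓ} (F : FunSet St) {L : CompleteLattice c ℓ₁ ℓ₂}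
    {α : Abs St → CompleteLattice.Carrier L} {γ : CompleteLattice.Carrier L → Abs St}
    (GI : GaloisInsertion L α γ) where
  open CompleteLattice L
  open GaloisInsertion GI
  open GaloisInsertionProperties GI
  open ForwardCompleteness F

  BackwardComplete : Set (lsuc (lsuc ℓ) ⊔ ℓ₁)
  BackwardComplete = ∀ X → α (F^ℳ F X) ≈ α (F^ℳ F (γ (α X)))

  ShellComplete : (Abs St → Abs St) → Set (lsuc (lsuc ℓ))
  ShellComplete 𝒮 = ∀ X → 𝒮 (γ (α X)) ≅ γ (α (𝒮 (γ (α X))))

  backwardComplete⇒γα-fwdComplete : BackwardComplete
                                   → ∀ {X} → FwdComplete F X → FwdComplete F (γ (α X))
  backwardComplete⇒γα-fwdComplete backward {X} X-complete =
    ⊑F^ℳ⇒FwdComplete (γ (α X))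
      (≤α⇒γ⊑ (trans (α-mono (FwdComplete⇒⊑F^ℳ X X-complete)) (reflexive (backward X))))

  shellComplete⇒≅γα : ∀ {𝒮} → (∀ A → IsFwdShell F A (𝒮 A)) → ShellComplete 𝒮
                    → ∀ a → 𝒮 (γ a) ≅ γ (α (𝒮 (γ a)))
  shellComplete⇒≅γα {𝒮} isShell complete a = begin
    𝒮 (γ a)                 ≈⟨ 𝒮-resp-≅ (swap γαγa≅γa) ⟩
    𝒮 (γ (α (γ a)))         ≈⟨ complete (γ a) ⟩
    γ (α (𝒮 (γ (α (γ a))))) ≈⟨ γ-resp-≈ (α-resp-≅ (𝒮-resp-≅ γαγa≅γa)) ⟩
    γ (α (𝒮 (γ a)))         ∎
    where
    open import Relation.Binary.Reasoning.Setoid ≅-setoid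
    𝒮-resp-≅ : ∀ {A B} → A ≅ B → 𝒮 A ≅ 𝒮 B
    𝒮-resp-≅ {A} {B} = IsFwdShell-resp-≅ A B (𝒮 A) (𝒮 B) (isShell A) (isShell B)
    γαγa≅γa : γ (α (γ a)) ≅ γ a
    γαγa≅γa = γ-resp-≈ (αγ a)

  γα𝒮γ-fwdComplete : ∀ {𝒮} → (∀ A → IsFwdShell F A (𝒮 A))
                   → BackwardComplete ⊎ ShellComplete 𝒮
                   → ∀ a → FwdComplete F (γ (α (𝒮 (γ a))))
  γα𝒮γ-fwdComplete {𝒮} isShell (inj₁ backward) a =
    backwardComplete⇒γα-fwdComplete backward
      (IsFwdShell-fwdComplete (γ a) (𝒮 (γ a)) (isShell (γ a)))
  γα𝒮γ-fwdComplete {𝒮} isShell (inj₂ complete) a =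
    FwdComplete-resp-≅ (𝒮 (γ a)) (γ (α (𝒮 (γ a)))) (shellComplete⇒≅γα {𝒮} isShell complete a)
      (IsFwdShell-fwdComplete (γ a) (𝒮 (γ a)) (isShell (γ a)))

module GPTRuns
    {ℓ c ℓ₁ ℓ₂ : Level} {St : Set ℓ} (F : FunSet St) {L : CompleteLattice c ℓ₁ ℓ₂}
    {α : Abs St → CompleteLattice.Carrier L} {γ : CompleteLattice.Carrier L → Abs St}
    (GI : GaloisInsertion L α γ) where
  open CompleteLattice L renaming (refl to ≤-refl)
  open GaloisInsertion GI
  open GaloisInsertionProperties GI
  open ForwardCompleteness F
  open GPT F L α γ

  step-< : ∀ {a b} → b ◁ a → b < a
  step-< (f , s , (_ , refined<a) , refl) = refined<a

  allRunsTerminate : DCC → ∀ a → AllRunsTerminate a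
  allRunsTerminate dcc a = Subrelation.accessible step-< (dcc a)

  run-≤ : ∀ {a b} → Star Step a b → b ≤ a
  run-≤ {a} run = Star-preserves (_≤ a) (λ step x≤a → trans (proj₁ (step-< step)) x≤a) run ≤-refl

  step-preserves-lowerBound : ∀ {d} → FwdComplete F (γ d) → ∀ {a b} → Step a b → d ≤ a → d ≤ b
  step-preserves-lowerBound {d} γd-complete {a} (f , s , (γa∋s , _) , refl) d≤a =
    γ⊑⇒≤α (refine-greatest f s (γ a) (γ d) γd⊑γa
      (γd-complete _ (f , s , (λ i → γd⊑γa (s i) (γa∋s i)) , ≐-refl)))
    where
    γd⊑γa : γ d ⊑ γ a
    γd⊑γa = γ-mono d≤a

  noRefiners⇒fwdComplete : ExcludedMiddle ℓ₁ → ∀ {b} → NoRefiners b → FwdComplete F (γ b)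
  noRefiners⇒fwdComplete lem {b} noRefiners S (f , s , γb∋s , S≐fs)
    with lem {refineᴬ f s b ≈ b}
  ... | yes refined≈b =
    IsMoore.resp (moore (γ b)) (≐-sym S≐fs)
      (≤α⇒γ⊑ (reflexive (Eq.sym refined≈b)) (app F f s) (refine-∋ f s (γ b)))
  ... | no refined≉b =
    ⊥-elim (noRefiners f s (γb∋s , ⊑γ⇒α≤ (refine-⊑ f s (γ b)) , refined≉b))

  output-≤-shell : ExcludedMiddle ℓ₁ → ∀ {a b B} → IsFwdShell F (γ a) B
                 → Star Step a b → NoRefiners b → b ≤ α B
  output-≤-shell lem {b = b} (upper , _) run noRefiners =
    γ⊑⇒≤α (upper (γ b) (γ-mono (run-≤ run)) (noRefiners⇒fwdComplete lem noRefiners))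

  shell-≤-run : ∀ {a b B} → IsFwdShell F (γ a) B → FwdComplete F (γ (α B))
              → Star Step a b → α B ≤ b
  shell-≤-run {a} {B = B} isShell γαB-complete run =
    Star-preserves (_ ≤_) (step-preserves-lowerBound γαB-complete) run
      (⊑γ⇒α≤ (IsFwdShell-⊑ (γ a) B isShell))

theorem4p3 : {ℓ c ℓ₁ ℓ₂ : Level}
    -- ambient classical logic
    → (∀ {p} → ExcludedMiddle p)
    → (St : Set ℓ) (F : FunSet St) (L : CompleteLattice c ℓ₁ ℓ₂)
    → (α : Abs St → CompleteLattice.Carrier L)
    → (γ : CompleteLattice.Carrier L → Abs St)
    → GaloisInsertion L α γ
    → CompleteLattice.DCC L
    -- 𝒮_F : the forward F-complete shell operator
    → (𝒮 : Abs St → Abs St) → (∀ A → IsFwdShell F A (𝒮 A))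
    -- (i) backward completeness for F^M  or  (ii) forward completeness for 𝒮_F
    → ((∀ X → CompleteLattice._≈_ L (α (F^ℳ F X)) (α (F^ℳ F (γ (α X)))))
       ⊎ (∀ X → 𝒮 (γ (α X)) ≅ γ (α (𝒮 (γ (α X))))))
    → ∀ a → GPT.AllRunsTerminate F L α γ a
          × (∀ b → GPT.Output F L α γ a b → CompleteLattice._≈_ L b (α (𝒮 (γ a))))
theorem4p3 lem St F L α γ GI dcc 𝒮 isShell completeness a =
  allRunsTerminate dcc a , λ b (run , noRefiners) →
    antisym (output-≤-shell lem (isShell (γ a)) run noRefiners)
            (shell-≤-run (isShell (γ a)) (γα𝒮γ-fwdComplete {𝒮} isShell completeness a) run)
  where
  open CompleteLattice L using (antisym)
  open Completeness F GI using (γα𝒮γ-fwdComplete)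
  open GPTRuns F GI
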